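{- A finite subset $A\subset\mathbb{Z}^2$ is a box if and only if it is $\ell_\infty$-connected and saturated.
   Context: $X$ is the graph with vertex set $\mathbb{Z}^2$ in which $(x,y)$ and $(x',y')$ are adjacent iff $|x-x'|+|y-y'|=1$. For $A\subset\mathbb{Z}^2$, $\partial A=\{u\in\mathbb{Z}^2\setminus A:\ u \text{ adjacent to some } v\in A\}$. $A$ is saturated if $|\partial(A\cup\{v\})|>|\partial A|$ for all $v\in\mathbb{Z}^2\setminus A$. Two points $u,v\in\mathbb{Z}^2$ are $\ell_\infty$-adjacent if $\max(|x-x'|,|y-y'|)=1$ where $u=(x,y)$, $v=(x',y')$; $A$ is $\ell_\infty$-connected if any two points of $A$ are joined by a sequence of points of $A$ with consecutive points $\ell_\infty$-adjacent. For integers $a,b,c,d$, $B(a,b,c,d)=\{(x,y): a\le y-x\le b,\ c\le y+x\le d\}$; a box is a nonempty set of this form. -}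

module Defs where

open import Data.Nat using (ℕ; _<_; _⊔_)
open import Data.Integer using (ℤ; _+_; _-_; ∣_∣; _≤_)
open import Data.Product using (_×_; _,_; Σ; ∃; ∃-syntax)
open import Data.Sum using (_⊎_)
open import Data.List using (List; length)
open import Data.List.Membership.Propositional using (_∈_)
open import Data.List.Relation.Unary.Unique.Propositional using (Unique)
open import Function.Bundles using (_⇔_)
open import Relation.Binary.PropositionalEquality using (_≡_)
open import Relation.Nullary using (¬_)

Point : Set
Point = ℤ × ℤ

Subset : Set₁
Subset = Point → Set

Adj : Point → Point → Set
Adj (x , y) (x' , y') = ∣ x - x' ∣ Data.Nat.+ ∣ y - y' ∣ ≡ 1

AdjInf : Point → Point → Set
AdjInf (x , y) (x' , y') = ∣ x - x' ∣ ⊔ ∣ y - y' ∣ ≡ 1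

∂ : Subset → Subset
∂ A u = ¬ A u × ∃[ v ] (A v × Adj u v)

insert : Subset → Point → Subset
insert A v u = A u ⊎ u ≡ v

HasSize : Subset → ℕ → Set
HasSize S n = Σ (List Point) λ l → Unique l × length l ≡ n × (∀ u → (u ∈ l) ⇔ S u)

Saturated : Subset → Set
Saturated A = ∀ v → ¬ A v → ∀ m n → HasSize (∂ A) m → HasSize (∂ (insert A v)) n → m < n

data InfWalk (A : Subset) : Point → Point → Set where
  here : ∀ {u} → A u → InfWalk A u u
  step : ∀ {u v w} → A u → AdjInf u v → InfWalk A v w → InfWalk A u w

InfConnected : Subset → Set
InfConnected A = ∀ u v → A u → A v → InfWalk A u v

B : ℤ → ℤ → ℤ → ℤ → Subset
B a b c d (x , y) = (a ≤ y - x × y - x ≤ b) × (c ≤ y + x × y + x ≤ d)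

IsBox : Subset → Set
IsBox A = ∃[ a ] ∃[ b ] ∃[ c ] ∃[ d ] ((∃[ u ] B a b c d u) × (∀ u → A u ⇔ B a b c d u))

⟦_⟧ : List Point → Subset
⟦ l ⟧ u = u ∈ l

-- In the coordinates σ = y - x, τ = y + x a box is a rectangle, a grid step changes both
-- coordinates by ±1, and an ℓ∞-step changes them by (±1, ±1), (±2, 0) or (0, ±2); all
-- lattice points have σ + τ even.
--
-- A box is ℓ∞-connected: walk inside it along steps that increase σ + τ by 2. It is
-- saturated: a point v outside it lies beyond one side, and its two neighbours further
-- out are not adjacent to the box, so adding v creates two boundary points and removes
-- only v.
--
-- Conversely, saturation makes A absorbing: a boundary point all of whose neighbours but
-- one lie in A ∪ ∂A belongs to A, since adding it would not enlarge the boundary. Starting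
-- from one point, follow ℓ∞-walks inside A and keep a box contained in A. When the walk
-- steps out of the current box, the row (or column) just outside is absorbed point by
-- point, so the box grows to contain the new point. Once the walks have visited every
-- point of A, the box contains A and is contained in A.
--
-- Each side of a box is handled once, in a "frame": the coordinates and grid moves seen
-- through a symmetry of ℤ² that maps boxes to boxes.

{-# OPTIONS --safe #-}
module Submission where

open import Defs
open import Data.Nat as ℕ using (ℕ; zero; suc; z≤n; s≤s)
import Data.Nat.Properties as ℕₚ
open import Data.Integer using (ℤ; +_; -[1+_]; _+_; _-_; -_; ∣_∣; _≤_; 0ℤ; 1ℤ; -1ℤ; +≤+; pred)
  renaming (suc to sucℤ)
open import Data.Integer.Properties
open import Data.Integer.Tactic.RingSolver using (solve-∀)
open import Data.Product using (_×_; _,_; ∃-syntax; proj₁; proj₂)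
open import Data.Product.Properties using (≡-dec)
open import Data.Sum using (_⊎_; inj₁; inj₂)
import Data.Sum as Sum
open import Data.Empty using (⊥-elim)
open import Data.List using (List; []; _∷_; _++_; length; filter; deduplicate)
open import Data.List.Properties using (length-++)
open import Data.List.Membership.Propositional using (_∈_)
open import Data.List.Membership.Propositional.Properties using (∈-∃++; ∈-filter⁺; ∈-filter⁻; ∈-deduplicate⁺; ∈-deduplicate⁻)
open import Data.List.Relation.Binary.Subset.Propositional using (_⊆_)
open import Data.List.Relation.Unary.Any using (here; there)
import Data.List.Relation.Unary.All as All
open import Data.List.Relation.Unary.AllPairs using (_∷_)
open import Data.List.Relation.Unary.Unique.Propositional using (Unique)
open import Data.List.Relation.Unary.Unique.DecPropositional.Properties using (deduplicate-!)
open import Function.Base using (_∘′_)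
open import Function.Bundles using (_⇔_; mk⇔; Equivalence)
open import Relation.Nullary using (¬_; Dec; yes; no)
open import Relation.Nullary.Decidable using (¬?)
open import Relation.Binary.PropositionalEquality

i-j≡k⇒i≡k+j : ∀ {i j k} → i - j ≡ k → i ≡ k + j
i-j≡k⇒i≡k+j {i} {j} refl = i≡[i-j]+j i j
  where
  i≡[i-j]+j : ∀ i j → i ≡ (i - j) + j
  i≡[i-j]+j = solve-∀

∣i-j∣≡0⇒i≡j : ∀ i j → ∣ i - j ∣ ≡ 0 → i ≡ j
∣i-j∣≡0⇒i≡j i j e = i-j≡0⇒i≡j i j (∣i∣≡0⇒i≡0 e)

∣i∣≡1⇒i≡±1 : ∀ i → ∣ i ∣ ≡ 1 → i ≡ 1ℤ ⊎ i ≡ -1ℤ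
∣i∣≡1⇒i≡±1 (+ suc zero) _ = inj₁ refl
∣i∣≡1⇒i≡±1 -[1+ zero ] _ = inj₂ refl

∣i-j∣≡1⇒i≡j±1 : ∀ {i j} → ∣ i - j ∣ ≡ 1 → i ≡ sucℤ j ⊎ i ≡ pred j
∣i-j∣≡1⇒i≡j±1 {i} {j} e with ∣i∣≡1⇒i≡±1 (i - j) e
... | inj₁ d = inj₁ (i-j≡k⇒i≡k+j d)
... | inj₂ d = inj₂ (i-j≡k⇒i≡k+j d)

m+n≡1-cases : ∀ m n → m ℕ.+ n ≡ 1 → (m ≡ 0 × n ≡ 1) ⊎ (m ≡ 1 × n ≡ 0)
m+n≡1-cases zero n e = inj₁ (refl , e)
m+n≡1-cases (suc zero) zero e = inj₂ (refl , refl)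

Even : ℤ → Set
Even i = ∃[ k ] (i ≡ k + k)

¬Even-1 : ¬ Even 1ℤ
¬Even-1 (+ zero , ())
¬Even-1 (+ suc zero , ())
¬Even-1 (+ suc (suc n) , e) with cong ∣_∣ e
... | ()
¬Even-1 (-[1+ n ] , ())

even-apart : ∀ i j k → i - j ≡ k + k → (∃[ n ] i ≡ j + + (n ℕ.+ n)) ⊎ (∃[ n ] j ≡ i + + (n ℕ.+ n))
even-apart i j (+ n) e = inj₁ (n , trans (i-j≡k⇒i≡k+j e) (+-comm _ j))
even-apart i j k@(-[1+ m ]) e = inj₂ (suc m , trans (i-j≡k⇒i≡k+j j-i≡-k-k) (+-comm _ i))
  where
  j-i≡-[i-j] : ∀ i j → j - i ≡ - (i - j)
  j-i≡-[i-j] = solve-∀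
  j-i≡-k-k : j - i ≡ - k + - k
  j-i≡-k-k = trans (j-i≡-[i-j] i j) (trans (cong -_ e) (neg-distrib-+ k k))

i+i≡j+j⇒i≡j : ∀ i j → i + i ≡ j + j → i ≡ j
i+i≡j+j⇒i≡j i j e = i-j≡0⇒i≡j i j (k+k≡0⇒k≡0 (i - j) (begin
  (i - j) + (i - j) ≡⟨ double-diff i j ⟩
  (i + i) - (j + j) ≡⟨ cong (_- (j + j)) e ⟩
  (j + j) - (j + j) ≡⟨ +-inverseʳ (j + j) ⟩
  0ℤ                ∎))
  where
  open ≡-Reasoning
  double-diff : ∀ i j → (i - j) + (i - j) ≡ (i + i) - (j + j)
  double-diff = solve-∀
  k+k≡0⇒k≡0 : ∀ k → k + k ≡ 0ℤ → k ≡ 0ℤ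
  k+k≡0⇒k≡0 (+ zero) _ = refl

suc[i]-i≡1 : ∀ i → (1ℤ + i) - i ≡ 1ℤ
suc[i]-i≡1 = solve-∀

∣suc[i]-i∣≡1 : ∀ i → ∣ sucℤ i - i ∣ ≡ 1
∣suc[i]-i∣≡1 i = cong ∣_∣ (suc[i]-i≡1 i)

∣pred[i]-i∣≡1 : ∀ i → ∣ pred i - i ∣ ≡ 1
∣pred[i]-i∣≡1 i = cong ∣_∣ (pred[i]-i≡-1 i)
  where
  pred[i]-i≡-1 : ∀ i → (-1ℤ + i) - i ≡ -1ℤ
  pred[i]-i≡-1 = solve-∀

¬≤⇒suc≤ : ∀ {i j} → ¬ (i ≤ j) → sucℤ j ≤ i
¬≤⇒suc≤ = i<j⇒suc[i]≤j ∘′ ≰⇒>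

¬≤pred⇒≤ : ∀ {i j} → ¬ (i ≤ pred j) → j ≤ i
¬≤pred⇒≤ {i} {j} h = subst (_≤ i) (suc-pred j) (¬≤⇒suc≤ h)

≤∧¬suc≤⇒≡ : ∀ {i j} → i ≤ j → ¬ (sucℤ i ≤ j) → i ≡ j
≤∧¬suc≤⇒≡ i≤j h = ≤∧≮⇒≡ i≤j (h ∘′ i<j⇒suc[i]≤j)

≤suc∧≰⇒≡suc : ∀ {i j} → i ≤ sucℤ j → ¬ (i ≤ j) → i ≡ sucℤ j
≤suc∧≰⇒≡suc i≤suc[j] i≰j = ≤-antisym i≤suc[j] (¬≤⇒suc≤ i≰j)

¬suc≤⇒≤ : ∀ {i j} → ¬ (sucℤ i ≤ j) → j ≤ i
¬suc≤⇒≤ {i} h = subst (_ ≤_) (pred-suc i) (i<j⇒i≤pred[j] (≰⇒> h))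

pred≤∧≰⇒≡pred : ∀ {i j} → pred j ≤ i → ¬ (j ≤ i) → i ≡ pred j
pred≤∧≰⇒≡pred pred[j]≤i j≰i = ≤-antisym (i<j⇒i≤pred[j] (≰⇒> j≰i)) pred[j]≤i

pred≤⇒≤suc : ∀ {i j} → pred i ≤ j → i ≤ sucℤ j
pred≤⇒≤suc {i} h = subst (_≤ _) (suc-pred i) (suc-mono h)

pred[i]≤i : ∀ i → pred i ≤ i
pred[i]≤i i = i≤j⇒pred[i]≤j ≤-refl

suc≰ : ∀ {i} → ¬ (sucℤ i ≤ i)
suc≰ h = <-irrefl refl (suc[i]≤j⇒i<j h)

≰⇒≥ : ∀ {i j} → ¬ (i ≤ j) → j ≤ i
≰⇒≥ = <⇒≤ ∘′ ≰⇒>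

¬≤⇒suc[-]≤- : ∀ {i j} → ¬ (i ≤ j) → sucℤ (- i) ≤ - j
¬≤⇒suc[-]≤- = i<j⇒suc[i]≤j ∘′ neg-mono-< ∘′ ≰⇒>

i≤-j⇒j≤-i : ∀ {i j} → i ≤ - j → j ≤ - i
i≤-j⇒j≤-i {i} {j} h = subst (_≤ - i) (neg-involutive j) (neg-mono-≤ h)

-i≤j⇒-j≤i : ∀ {i j} → - i ≤ j → - j ≤ i
-i≤j⇒-j≤i {i} {j} h = subst (- j ≤_) (neg-involutive i) (neg-mono-≤ h)

within-one : ∀ {a b x y} → a ≤ x → x ≤ b → y ≡ sucℤ x ⊎ y ≡ x ⊎ y ≡ pred x → pred a ≤ y × y ≤ sucℤ b
within-one {a} a≤x x≤b (inj₁ refl) = i≤j⇒pred[i]≤j (i≤j⇒i≤1+j a≤x) , suc-mono x≤b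
within-one a≤x x≤b (inj₂ (inj₁ refl)) = i≤j⇒pred[i]≤j a≤x , i≤j⇒i≤1+j x≤b
within-one a≤x x≤b (inj₂ (inj₂ refl)) = pred-mono a≤x , i≤j⇒i≤1+j (i≤j⇒pred[i]≤j x≤b)

module _ {A : Set} where

  ∈-++-remove : ∀ {x y : A} ys₁ ys₂ → y ∈ ys₁ ++ x ∷ ys₂ → y ≢ x → y ∈ ys₁ ++ ys₂
  ∈-++-remove [] ys₂ (here refl) y≢x = ⊥-elim (y≢x refl)
  ∈-++-remove [] ys₂ (there y∈) _ = y∈
  ∈-++-remove (z ∷ ys₁) ys₂ (here refl) _ = here refl
  ∈-++-remove (z ∷ ys₁) ys₂ (there y∈) y≢x = there (∈-++-remove ys₁ ys₂ y∈ y≢x)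

  Unique-⊆⇒length≤ : ∀ {xs ys : List A} → Unique xs → xs ⊆ ys → length xs ℕ.≤ length ys
  Unique-⊆⇒length≤ {[]} _ _ = z≤n
  Unique-⊆⇒length≤ {x ∷ xs} (x∉xs ∷ unique) xs⊆ys with ∈-∃++ (xs⊆ys (here refl))
  ... | ys₁ , ys₂ , refl = subst (suc (length xs) ℕ.≤_) (sym length-split)
        (s≤s (Unique-⊆⇒length≤ unique (λ y∈xs → ∈-++-remove ys₁ ys₂ (xs⊆ys (there y∈xs))
                                                   (λ y≡x → All.lookup x∉xs y∈xs (sym y≡x)))))
    where
    length-split : length (ys₁ ++ x ∷ ys₂) ≡ suc (length (ys₁ ++ ys₂))
    length-split = trans (length-++ ys₁) (trans (ℕₚ.+-suc (length ys₁) (length ys₂)) (cong suc (sym (length-++ ys₁))))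

-- Diagonal coordinates on the grid

σ₀ τ₀ : Point → ℤ
σ₀ (x , y) = y - x
τ₀ (x , y) = y + x

north₀ east₀ south₀ west₀ : Point → Point
north₀ (x , y) = x , sucℤ y
east₀ (x , y) = sucℤ x , y
south₀ (x , y) = x , pred y
west₀ (x , y) = pred x , y

Adj-sym : ∀ u v → Adj u v → Adj v u
Adj-sym (x , y) (x′ , y′) h rewrite ∣i-j∣≡∣j-i∣ x x′ | ∣i-j∣≡∣j-i∣ y y′ = h

AdjInf-sym : ∀ u v → AdjInf u v → AdjInf v u
AdjInf-sym (x , y) (x′ , y′) h rewrite ∣i-j∣≡∣j-i∣ x x′ | ∣i-j∣≡∣j-i∣ y y′ = h

Adj-irrefl : ∀ u → ¬ Adj u u
Adj-irrefl (x , y) h rewrite +-inverseʳ x | +-inverseʳ y with h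
... | ()

north₀-adj : ∀ u → Adj (north₀ u) u
north₀-adj (x , y) rewrite +-inverseʳ x | ∣suc[i]-i∣≡1 y = refl

east₀-adj : ∀ u → Adj (east₀ u) u
east₀-adj (x , y) rewrite +-inverseʳ y | ∣suc[i]-i∣≡1 x = refl

south₀-adj : ∀ u → Adj (south₀ u) u
south₀-adj (x , y) rewrite +-inverseʳ x | ∣pred[i]-i∣≡1 y = refl

west₀-adj : ∀ u → Adj (west₀ u) u
west₀-adj (x , y) rewrite +-inverseʳ y | ∣pred[i]-i∣≡1 x = refl

adj₀-cases : ∀ u v → Adj u v → u ≡ north₀ v ⊎ u ≡ east₀ v ⊎ u ≡ south₀ v ⊎ u ≡ west₀ v
adj₀-cases (x , y) (x′ , y′) h with m+n≡1-cases ∣ x - x′ ∣ ∣ y - y′ ∣ h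
... | inj₁ (dx , dy) with ∣i-j∣≡0⇒i≡j x x′ dx | ∣i-j∣≡1⇒i≡j±1 {y} {y′} dy
...   | refl | inj₁ refl = inj₁ refl
...   | refl | inj₂ refl = inj₂ (inj₂ (inj₁ refl))
adj₀-cases (x , y) (x′ , y′) h | inj₂ (dx , dy) with ∣i-j∣≡1⇒i≡j±1 {x} {x′} dx | ∣i-j∣≡0⇒i≡j y y′ dy
...   | inj₁ refl | refl = inj₂ (inj₁ refl)
...   | inj₂ refl | refl = inj₂ (inj₂ (inj₂ refl))

σ₀τ₀-injective : ∀ u w → σ₀ u ≡ σ₀ w → τ₀ u ≡ τ₀ w → u ≡ w
σ₀τ₀-injective (x , y) (x′ , y′) eσ eτ = cong₂ _,_ x≡x′ y≡y′
  where
  y+y≡σ+τ : ∀ x y → y + y ≡ (y - x) + (y + x)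
  y+y≡σ+τ = solve-∀
  x≡τ-y : ∀ x y → x ≡ (y + x) - y
  x≡τ-y = solve-∀
  y≡y′ : y ≡ y′
  y≡y′ = i+i≡j+j⇒i≡j y y′ (trans (y+y≡σ+τ x y) (trans (cong₂ _+_ eσ eτ) (sym (y+y≡σ+τ x′ y′))))
  x≡x′ : x ≡ x′
  x≡x′ = trans (x≡τ-y x y) (trans (cong₂ _-_ eτ y≡y′) (sym (x≡τ-y x′ y′)))

σ₀τ₀-parity : ∀ u w → Even ((σ₀ u - σ₀ w) + (τ₀ u - τ₀ w))
σ₀τ₀-parity (x , y) (x′ , y′) = y - y′ , Δσ+Δτ≡2Δy x y x′ y′
  where
  Δσ+Δτ≡2Δy : ∀ x y x′ y′ → ((y - x) - (y′ - x′)) + ((y + x) - (y′ + x′)) ≡ (y - y′) + (y - y′)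
  Δσ+Δτ≡2Δy = solve-∀

IsSign : ℤ → Set
IsSign i = i ≡ 0ℤ ⊎ i ≡ 1ℤ ⊎ i ≡ -1ℤ

∣i∣≤1⇒IsSign : ∀ i → ∣ i ∣ ℕ.≤ 1 → IsSign i
∣i∣≤1⇒IsSign (+ zero) _ = inj₁ refl
∣i∣≤1⇒IsSign (+ suc zero) _ = inj₂ (inj₁ refl)
∣i∣≤1⇒IsSign -[1+ zero ] _ = inj₂ (inj₂ refl)
∣i∣≤1⇒IsSign (+ suc (suc n)) (s≤s ())
∣i∣≤1⇒IsSign -[1+ suc n ] (s≤s ())

∣i+i∣≤2⇒∣i∣≤1 : ∀ i → ∣ i + i ∣ ℕ.≤ 2 → ∣ i ∣ ℕ.≤ 1
∣i+i∣≤2⇒∣i∣≤1 (+ zero) _ = z≤n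
∣i+i∣≤2⇒∣i∣≤1 (+ suc zero) _ = s≤s z≤n
∣i+i∣≤2⇒∣i∣≤1 (+ suc (suc n)) (s≤s (s≤s h)) with subst (ℕ._≤ 0) (ℕₚ.+-suc n (suc n)) h
... | ()
∣i+i∣≤2⇒∣i∣≤1 -[1+ zero ] _ = s≤s z≤n
∣i+i∣≤2⇒∣i∣≤1 -[1+ suc n ] (s≤s (s≤s ()))

unit-offset⇔ : ∀ {dx dy} → IsSign dx → IsSign dy →
               (∣ dx ∣ ℕ.⊔ ∣ dy ∣ ≡ 1) ⇔ (∣ dy - dx ∣ ℕ.+ ∣ dy + dx ∣ ≡ 2)
unit-offset⇔ (inj₁ refl) (inj₁ refl) = mk⇔ (λ ()) (λ ())
unit-offset⇔ (inj₁ refl) (inj₂ (inj₁ refl)) = mk⇔ (λ _ → refl) (λ _ → refl)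
unit-offset⇔ (inj₁ refl) (inj₂ (inj₂ refl)) = mk⇔ (λ _ → refl) (λ _ → refl)
unit-offset⇔ (inj₂ (inj₁ refl)) (inj₁ refl) = mk⇔ (λ _ → refl) (λ _ → refl)
unit-offset⇔ (inj₂ (inj₁ refl)) (inj₂ (inj₁ refl)) = mk⇔ (λ _ → refl) (λ _ → refl)
unit-offset⇔ (inj₂ (inj₁ refl)) (inj₂ (inj₂ refl)) = mk⇔ (λ _ → refl) (λ _ → refl)
unit-offset⇔ (inj₂ (inj₂ refl)) (inj₁ refl) = mk⇔ (λ _ → refl) (λ _ → refl)
unit-offset⇔ (inj₂ (inj₂ refl)) (inj₂ (inj₁ refl)) = mk⇔ (λ _ → refl) (λ _ → refl)
unit-offset⇔ (inj₂ (inj₂ refl)) (inj₂ (inj₂ refl)) = mk⇔ (λ _ → refl) (λ _ → refl)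

offset⇔ : ∀ dx dy → (∣ dx ∣ ℕ.⊔ ∣ dy ∣ ≡ 1) ⇔ (∣ dy - dx ∣ ℕ.+ ∣ dy + dx ∣ ≡ 2)
offset⇔ dx dy = mk⇔ to from
  where
  to : ∣ dx ∣ ℕ.⊔ ∣ dy ∣ ≡ 1 → ∣ dy - dx ∣ ℕ.+ ∣ dy + dx ∣ ≡ 2
  to h = Equivalence.to (unit-offset⇔ (∣i∣≤1⇒IsSign dx ∣dx∣≤1) (∣i∣≤1⇒IsSign dy ∣dy∣≤1)) h
    where
    ∣dx∣≤1 = subst (∣ dx ∣ ℕ.≤_) h (ℕₚ.m≤m⊔n ∣ dx ∣ ∣ dy ∣)
    ∣dy∣≤1 = subst (∣ dy ∣ ℕ.≤_) h (ℕₚ.m≤n⊔m ∣ dx ∣ ∣ dy ∣)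
  2dx≡ : ∀ dx dy → dx + dx ≡ (dy + dx) - (dy - dx)
  2dx≡ = solve-∀
  2dy≡ : ∀ dx dy → dy + dy ≡ (dy + dx) + (dy - dx)
  2dy≡ = solve-∀
  from : ∣ dy - dx ∣ ℕ.+ ∣ dy + dx ∣ ≡ 2 → ∣ dx ∣ ℕ.⊔ ∣ dy ∣ ≡ 1
  from h = Equivalence.from (unit-offset⇔ (∣i∣≤1⇒IsSign dx ∣dx∣≤1) (∣i∣≤1⇒IsSign dy ∣dy∣≤1)) h
    where
    sum≤2 : ∣ dy + dx ∣ ℕ.+ ∣ dy - dx ∣ ℕ.≤ 2
    sum≤2 = ℕₚ.≤-reflexive (trans (ℕₚ.+-comm ∣ dy + dx ∣ ∣ dy - dx ∣) h)
    ∣dx∣≤1 = ∣i+i∣≤2⇒∣i∣≤1 dx (subst (λ z → ∣ z ∣ ℕ.≤ 2) (sym (2dx≡ dx dy))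
               (ℕₚ.≤-trans (∣i-j∣≤∣i∣+∣j∣ (dy + dx) (dy - dx)) sum≤2))
    ∣dy∣≤1 = ∣i+i∣≤2⇒∣i∣≤1 dy (subst (λ z → ∣ z ∣ ℕ.≤ 2) (sym (2dy≡ dx dy))
               (ℕₚ.≤-trans (∣i+j∣≤∣i∣+∣j∣ (dy + dx) (dy - dx)) sum≤2))

DiagStep : ℤ → ℤ → Set
DiagStep Δσ Δτ = ∣ Δσ ∣ ℕ.+ ∣ Δτ ∣ ≡ 2

AdjInf⇔σ₀τ₀-step : ∀ u w → AdjInf u w ⇔ DiagStep (σ₀ u - σ₀ w) (τ₀ u - τ₀ w)
AdjInf⇔σ₀τ₀-step (x , y) (x′ , y′) =
  subst₂ (λ s t → AdjInf (x , y) (x′ , y′) ⇔ DiagStep s t) (sym (Δσ≡ x y x′ y′)) (sym (Δτ≡ x y x′ y′))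
         (offset⇔ (x - x′) (y - y′))
  where
  Δσ≡ : ∀ x y x′ y′ → (y - x) - (y′ - x′) ≡ (y - y′) - (x - x′)
  Δσ≡ = solve-∀
  Δτ≡ : ∀ x y x′ y′ → (y + x) - (y′ + x′) ≡ (y - y′) + (x - x′)
  Δτ≡ = solve-∀

upward-step : ∀ Δσ Δτ → DiagStep Δσ Δτ → 1ℤ ≤ Δτ →
              (Δτ ≡ 1ℤ × (Δσ ≡ 1ℤ ⊎ Δσ ≡ -1ℤ)) ⊎ (Δτ ≡ + 2 × Δσ ≡ 0ℤ)
upward-step Δσ (+ suc k) diag _ with m+n≡1-cases ∣ Δσ ∣ k (ℕₚ.suc-injective (trans (sym (ℕₚ.+-suc ∣ Δσ ∣ k)) diag))
... | inj₁ (∣Δσ∣≡0 , refl) = inj₂ (refl , ∣i∣≡0⇒i≡0 ∣Δσ∣≡0)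
... | inj₂ (∣Δσ∣≡1 , refl) = inj₁ (refl , ∣i∣≡1⇒i≡±1 Δσ ∣Δσ∣≡1)
upward-step Δσ (+ zero) _ (+≤+ ())

-- Frames

record Frame : Set where
  field
    σ τ : Point → ℤ
    north east south west : Point → Point
    σ-north : ∀ u → σ (north u) ≡ sucℤ (σ u)
    τ-north : ∀ u → τ (north u) ≡ sucℤ (τ u)
    σ-east  : ∀ u → σ (east u) ≡ pred (σ u)
    τ-east  : ∀ u → τ (east u) ≡ sucℤ (τ u)
    σ-south : ∀ u → σ (south u) ≡ pred (σ u)
    τ-south : ∀ u → τ (south u) ≡ pred (τ u)
    σ-west  : ∀ u → σ (west u) ≡ sucℤ (σ u)
    τ-west  : ∀ u → τ (west u) ≡ pred (τ u)
    north-adj : ∀ u → Adj (north u) u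
    east-adj  : ∀ u → Adj (east u) u
    south-adj : ∀ u → Adj (south u) u
    west-adj  : ∀ u → Adj (west u) u
    adj-cases : ∀ u v → Adj u v → u ≡ north v ⊎ u ≡ east v ⊎ u ≡ south v ⊎ u ≡ west v
    στ-injective : ∀ u w → σ u ≡ σ w → τ u ≡ τ w → u ≡ w
    parity : ∀ u w → Even ((σ u - σ w) + (τ u - τ w))
    AdjInf⇔step : ∀ u w → AdjInf u w ⇔ DiagStep (σ u - σ w) (τ u - τ w)

standardFrame : Frame
standardFrame = record
  { σ = σ₀ ; τ = τ₀ ; north = north₀ ; east = east₀ ; south = south₀ ; west = west₀
  ; σ-north = λ (x , y) → +-assoc 1ℤ y (- x)
  ; τ-north = λ (x , y) → +-assoc 1ℤ y x
  ; σ-east  = λ (x , y) → y-[c+x] 1ℤ x y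
  ; τ-east  = λ (x , y) → y+[c+x] 1ℤ x y
  ; σ-south = λ (x , y) → +-assoc -1ℤ y (- x)
  ; τ-south = λ (x , y) → +-assoc -1ℤ y x
  ; σ-west  = λ (x , y) → y-[c+x] -1ℤ x y
  ; τ-west  = λ (x , y) → y+[c+x] -1ℤ x y
  ; north-adj = north₀-adj ; east-adj = east₀-adj ; south-adj = south₀-adj ; west-adj = west₀-adj
  ; adj-cases = adj₀-cases
  ; στ-injective = σ₀τ₀-injective
  ; parity = σ₀τ₀-parity
  ; AdjInf⇔step = AdjInf⇔σ₀τ₀-step
  }
  where
  y-[c+x] : ∀ c x y → y - (c + x) ≡ - c + (y - x)
  y-[c+x] = solve-∀
  y+[c+x] : ∀ c x y → y + (c + x) ≡ c + (y + x)
  y+[c+x] = solve-∀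

swapAxes : Frame → Frame
swapAxes F = record
  { σ = τ ; τ = σ ; north = north ; east = west ; south = south ; west = east
  ; σ-north = τ-north ; τ-north = σ-north ; σ-east = τ-west ; τ-east = σ-west
  ; σ-south = τ-south ; τ-south = σ-south ; σ-west = τ-east ; τ-west = σ-east
  ; north-adj = north-adj ; east-adj = west-adj ; south-adj = south-adj ; west-adj = east-adj
  ; adj-cases = cases
  ; στ-injective = λ u w eσ eτ → στ-injective u w eτ eσ
  ; parity = λ u w → subst Even (+-comm (σ u - σ w) (τ u - τ w)) (parity u w)
  ; AdjInf⇔step = λ u w → subst (λ n → AdjInf u w ⇔ (n ≡ 2)) (ℕₚ.+-comm ∣ σ u - σ w ∣ ∣ τ u - τ w ∣) (AdjInf⇔step u w)
  }
  where
  open Frame F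
  cases : ∀ u v → Adj u v → u ≡ north v ⊎ u ≡ west v ⊎ u ≡ south v ⊎ u ≡ east v
  cases u v h with adj-cases u v h
  ... | inj₁ e = inj₁ e
  ... | inj₂ (inj₁ e) = inj₂ (inj₂ (inj₂ e))
  ... | inj₂ (inj₂ (inj₁ e)) = inj₂ (inj₂ (inj₁ e))
  ... | inj₂ (inj₂ (inj₂ e)) = inj₂ (inj₁ e)

negateτ : Frame → Frame
negateτ F = record
  { σ = σ ; τ = λ u → - τ u ; north = west ; east = south ; south = east ; west = north
  ; σ-north = σ-west ; σ-east = σ-south ; σ-south = σ-east ; σ-west = σ-north
  ; τ-north = λ u → trans (cong -_ (τ-west u)) (neg-distrib-+ -1ℤ (τ u))
  ; τ-east  = λ u → trans (cong -_ (τ-south u)) (neg-distrib-+ -1ℤ (τ u))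
  ; τ-south = λ u → trans (cong -_ (τ-east u)) (neg-distrib-+ 1ℤ (τ u))
  ; τ-west  = λ u → trans (cong -_ (τ-north u)) (neg-distrib-+ 1ℤ (τ u))
  ; north-adj = west-adj ; east-adj = south-adj ; south-adj = east-adj ; west-adj = north-adj
  ; adj-cases = cases
  ; στ-injective = λ u w eσ eτ → στ-injective u w eσ (neg-injective eτ)
  ; parity = λ u w → let (k , e) = parity u w in
      k - (τ u - τ w) , reflect (σ u - σ w) (τ u) (τ w) k e
  ; AdjInf⇔step = λ u w → subst (λ n → AdjInf u w ⇔ (∣ σ u - σ w ∣ ℕ.+ n ≡ 2))
                            (sym (∣-τu+τw∣ u w)) (AdjInf⇔step u w)
  }
  where
  open Frame F
  reflect : ∀ s a b k → s + (a - b) ≡ k + k → s + (- a - - b) ≡ (k - (a - b)) + (k - (a - b))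
  reflect s a b k e = trans (shift s a b) (trans (cong (_- ((a - b) + (a - b))) e) (regroup k (a - b)))
    where
    shift : ∀ s a b → s + (- a - - b) ≡ (s + (a - b)) - ((a - b) + (a - b))
    shift = solve-∀
    regroup : ∀ k t → (k + k) - (t + t) ≡ (k - t) + (k - t)
    regroup = solve-∀
  ∣-τu+τw∣ : ∀ u w → ∣ - τ u - - τ w ∣ ≡ ∣ τ u - τ w ∣
  ∣-τu+τw∣ u w = trans (cong ∣_∣ (sym (neg-distrib-+ (τ u) (- τ w)))) (∣-i∣≡∣i∣ (τ u - τ w))
  cases : ∀ u v → Adj u v → u ≡ west v ⊎ u ≡ south v ⊎ u ≡ east v ⊎ u ≡ north v
  cases u v h with adj-cases u v h
  ... | inj₁ e = inj₂ (inj₂ (inj₂ e))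
  ... | inj₂ (inj₁ e) = inj₂ (inj₂ (inj₁ e))
  ... | inj₂ (inj₂ (inj₁ e)) = inj₂ (inj₁ e)
  ... | inj₂ (inj₂ (inj₂ e)) = inj₁ e

negateσ : Frame → Frame
negateσ F = swapAxes (negateτ (swapAxes F))

module _ (F : Frame) where
  open Frame F

  σ≡⇒τ≢suc : ∀ {u p} → σ u ≡ σ p → τ u ≢ sucℤ (τ p)
  σ≡⇒τ≢suc {u} {p} eσ eτ = ¬Even-1 (subst Even Δσ+Δτ≡1 (parity u p))
    where
    Δσ+Δτ≡1 : (σ u - σ p) + (τ u - τ p) ≡ 1ℤ
    Δσ+Δτ≡1 = cong₂ _+_ (trans (cong (_- σ p) eσ) (+-inverseʳ (σ p)))
                        (trans (cong (_- τ p) eτ) (suc[i]-i≡1 (τ p)))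

  τ≡⇒σ-even-apart : ∀ {u q} → τ u ≡ τ q →
                    (∃[ n ] σ u ≡ σ q + + (n ℕ.+ n)) ⊎ (∃[ n ] σ q ≡ σ u + + (n ℕ.+ n))
  τ≡⇒σ-even-apart {u} {q} eτ = even-apart (σ u) (σ q) k Δσ≡k+k
    where
    open ≡-Reasoning
    k = proj₁ (parity u q)
    Δσ≡k+k : σ u - σ q ≡ k + k
    Δσ≡k+k = begin
      σ u - σ q                 ≡⟨ +-identityʳ _ ⟨
      (σ u - σ q) + 0ℤ          ≡⟨ cong (λ t → (σ u - σ q) + t) (trans (cong (_- τ q) eτ) (+-inverseʳ (τ q))) ⟨
      (σ u - σ q) + (τ u - τ q) ≡⟨ proj₂ (parity u q) ⟩
      k + k                     ∎

record Box (F : Frame) (a b c d : ℤ) (u : Point) : Set where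
  constructor box
  open Frame F
  field
    a≤σ : a ≤ σ u
    σ≤b : σ u ≤ b
    c≤τ : c ≤ τ u
    τ≤d : τ u ≤ d

Filled : Frame → Subset → ℤ → ℤ → ℤ → ℤ → Set
Filled F A a b c d = ∀ u → Box F a b c d u → A u

-- The witnesses of the bounds drive the parity arguments when the box is one point thick.
record Tight (F : Frame) (a b c d : ℤ) : Set where
  constructor mkTight
  open Frame F
  field
    σ-lo : ∃[ u ] (Box F a b c d u × σ u ≡ a)
    σ-hi : ∃[ u ] (Box F a b c d u × σ u ≡ b)
    τ-lo : ∃[ u ] (Box F a b c d u × τ u ≡ c)
    τ-hi : ∃[ u ] (Box F a b c d u × τ u ≡ d)

record Enlargement (F : Frame) (A : Subset) (a b c d : ℤ) (q : Point) : Set where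
  constructor enlargement
  field
    a′ b′ c′ d′ : ℤ
    filled : Filled F A a′ b′ c′ d′
    tight : Tight F a′ b′ c′ d′
    ⊇old : ∀ u → Box F a b c d u → Box F a′ b′ c′ d′ u
    ∋q : Box F a′ b′ c′ d′ q

module _ {F : Frame} {a b c d : ℤ} where

  Tight⇒a≤b : Tight F a b c d → a ≤ b
  Tight⇒a≤b (mkTight (_ , inBox , _) _ _ _) = ≤-trans (Box.a≤σ inBox) (Box.σ≤b inBox)

  Tight⇒c≤d : Tight F a b c d → c ≤ d
  Tight⇒c≤d (mkTight _ _ (_ , inBox , _) _) = ≤-trans (Box.c≤τ inBox) (Box.τ≤d inBox)

  Box-swapAxes : ∀ {u} → Box F a b c d u → Box (swapAxes F) c d a b u
  Box-swapAxes (box a≤σ σ≤b c≤τ τ≤d) = box c≤τ τ≤d a≤σ σ≤b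

  Box-swapAxes⁻ : ∀ {u} → Box (swapAxes F) c d a b u → Box F a b c d u
  Box-swapAxes⁻ (box c≤τ τ≤d a≤σ σ≤b) = box a≤σ σ≤b c≤τ τ≤d

  Box-negateτ : ∀ {u} → Box F a b c d u → Box (negateτ F) a b (- d) (- c) u
  Box-negateτ (box a≤σ σ≤b c≤τ τ≤d) = box a≤σ σ≤b (neg-mono-≤ τ≤d) (neg-mono-≤ c≤τ)

  Box-negateτ⁻ : ∀ {u} → Box (negateτ F) a b (- d) (- c) u → Box F a b c d u
  Box-negateτ⁻ (box a≤σ σ≤b -d≤-τ -τ≤-c) = box a≤σ σ≤b (neg-cancel-≤ -τ≤-c) (neg-cancel-≤ -d≤-τ)

  Box-negateτ′ : ∀ {u} → Box F a b (- d) (- c) u → Box (negateτ F) a b c d u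
  Box-negateτ′ (box a≤σ σ≤b -d≤τ τ≤-c) = box a≤σ σ≤b (i≤-j⇒j≤-i τ≤-c) (-i≤j⇒-j≤i -d≤τ)

  Box-negateτ⁻′ : ∀ {u} → Box (negateτ F) a b c d u → Box F a b (- d) (- c) u
  Box-negateτ⁻′ (box a≤σ σ≤b c≤-τ -τ≤d) = box a≤σ σ≤b (-i≤j⇒-j≤i -τ≤d) (i≤-j⇒j≤-i c≤-τ)

  Filled-swapAxes : ∀ {A} → Filled F A a b c d → Filled (swapAxes F) A c d a b
  Filled-swapAxes filled u = filled u ∘′ Box-swapAxes⁻

  Filled-swapAxes⁻ : ∀ {A} → Filled (swapAxes F) A c d a b → Filled F A a b c d
  Filled-swapAxes⁻ filled u = filled u ∘′ Box-swapAxes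

  Filled-negateτ : ∀ {A} → Filled F A a b c d → Filled (negateτ F) A a b (- d) (- c)
  Filled-negateτ filled u = filled u ∘′ Box-negateτ⁻

  Filled-negateτ⁻ : ∀ {A} → Filled (negateτ F) A a b c d → Filled F A a b (- d) (- c)
  Filled-negateτ⁻ filled u = filled u ∘′ Box-negateτ′

  Tight-swapAxes : Tight F a b c d → Tight (swapAxes F) c d a b
  Tight-swapAxes (mkTight (u₁ , b₁ , e₁) (u₂ , b₂ , e₂) (u₃ , b₃ , e₃) (u₄ , b₄ , e₄)) =
    mkTight (u₃ , Box-swapAxes b₃ , e₃) (u₄ , Box-swapAxes b₄ , e₄)
            (u₁ , Box-swapAxes b₁ , e₁) (u₂ , Box-swapAxes b₂ , e₂)

  Tight-swapAxes⁻ : Tight (swapAxes F) c d a b → Tight F a b c d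
  Tight-swapAxes⁻ (mkTight (u₃ , b₃ , e₃) (u₄ , b₄ , e₄) (u₁ , b₁ , e₁) (u₂ , b₂ , e₂)) =
    mkTight (u₁ , Box-swapAxes⁻ b₁ , e₁) (u₂ , Box-swapAxes⁻ b₂ , e₂)
            (u₃ , Box-swapAxes⁻ b₃ , e₃) (u₄ , Box-swapAxes⁻ b₄ , e₄)

  Tight-negateτ : Tight F a b c d → Tight (negateτ F) a b (- d) (- c)
  Tight-negateτ (mkTight (u₁ , b₁ , e₁) (u₂ , b₂ , e₂) (u₃ , b₃ , e₃) (u₄ , b₄ , e₄)) =
    mkTight (u₁ , Box-negateτ b₁ , e₁) (u₂ , Box-negateτ b₂ , e₂)
            (u₄ , Box-negateτ b₄ , cong -_ e₄) (u₃ , Box-negateτ b₃ , cong -_ e₃)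

  Tight-negateτ⁻ : Tight (negateτ F) a b c d → Tight F a b (- d) (- c)
  Tight-negateτ⁻ (mkTight (u₁ , b₁ , e₁) (u₂ , b₂ , e₂) (u₃ , b₃ , e₃) (u₄ , b₄ , e₄)) =
    mkTight (u₁ , Box-negateτ⁻′ b₁ , e₁) (u₂ , Box-negateτ⁻′ b₂ , e₂)
            (u₄ , Box-negateτ⁻′ b₄ , -i≡j⇒i≡-j e₄) (u₃ , Box-negateτ⁻′ b₃ , -i≡j⇒i≡-j e₃)
    where
    -i≡j⇒i≡-j : ∀ {i j} → - i ≡ j → i ≡ - j
    -i≡j⇒i≡-j {i} refl = sym (neg-involutive i)

module _ {F : Frame} {A : Subset} {a b c d : ℤ} {q : Point} where

  Enlargement-swapAxes⁻ : Enlargement (swapAxes F) A c d a b q → Enlargement F A a b c d q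
  Enlargement-swapAxes⁻ (enlargement a′ b′ c′ d′ filled tight ⊇old ∋q) =
    enlargement c′ d′ a′ b′ (Filled-swapAxes⁻ filled) (Tight-swapAxes⁻ tight)
                (λ u → Box-swapAxes⁻ ∘′ ⊇old u ∘′ Box-swapAxes) (Box-swapAxes⁻ ∋q)

  Enlargement-negateτ⁻ : Enlargement (negateτ F) A a b (- d) (- c) q → Enlargement F A a b c d q
  Enlargement-negateτ⁻ (enlargement a′ b′ c′ d′ filled tight ⊇old ∋q) =
    enlargement a′ b′ (- d′) (- c′) (Filled-negateτ⁻ {F} filled) (Tight-negateτ⁻ {F} tight)
                (λ u → Box-negateτ⁻′ ∘′ ⊇old u ∘′ Box-negateτ) (Box-negateτ⁻′ ∋q)

module _ {F : Frame} {a b c d : ℤ} where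

  Box-negateσ : ∀ {u} → Box F a b c d u → Box (negateσ F) (- b) (- a) c d u
  Box-negateσ = Box-swapAxes {negateτ (swapAxes F)} ∘′ Box-negateτ {swapAxes F} ∘′ Box-swapAxes {F}

  Filled-negateσ : ∀ {A} → Filled F A a b c d → Filled (negateσ F) A (- b) (- a) c d
  Filled-negateσ = Filled-swapAxes {negateτ (swapAxes F)} ∘′ Filled-negateτ {swapAxes F} ∘′ Filled-swapAxes {F}

  Tight-negateσ : Tight F a b c d → Tight (negateσ F) (- b) (- a) c d
  Tight-negateσ = Tight-swapAxes {negateτ (swapAxes F)} ∘′ Tight-negateτ {swapAxes F} ∘′ Tight-swapAxes {F}

module _ {F : Frame} where
  open Frame F

  box≡ : ∀ {a b c d v s t} → σ v ≡ s → τ v ≡ t → a ≤ s → s ≤ b → c ≤ t → t ≤ d → Box F a b c d v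
  box≡ refl refl = box

  Box-mono : ∀ {a b c d a′ b′ c′ d′ u} → a′ ≤ a → b ≤ b′ → c′ ≤ c → d ≤ d′ →
             Box F a b c d u → Box F a′ b′ c′ d′ u
  Box-mono a′≤a b≤b′ c′≤c d≤d′ (box a≤σ σ≤b c≤τ τ≤d) =
    box (≤-trans a′≤a a≤σ) (≤-trans σ≤b b≤b′) (≤-trans c′≤c c≤τ) (≤-trans τ≤d d≤d′)

  Filled-extend-top : ∀ {A a b c d} → Filled F A a b c d →
                      (∀ u → τ u ≡ sucℤ d → a ≤ σ u → σ u ≤ b → A u) → Filled F A a b c (sucℤ d)
  Filled-extend-top filled row u (box a≤σ σ≤b c≤τ τ≤sd) with τ u ≤? _
  ... | yes τ≤d = filled u (box a≤σ σ≤b c≤τ τ≤d)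
  ... | no τ≰d = row u (≤-antisym τ≤sd (i<j⇒suc[i]≤j (≰⇒> τ≰d))) a≤σ σ≤b

  Tight-extend-top : ∀ {a b c d d′ v} → Tight F a b c d → d ≤ d′ → Box F a b c d′ v → τ v ≡ d′ →
                     Tight F a b c d′
  Tight-extend-top {a} {b} {c} {d} {d′} (mkTight (u₁ , b₁ , e₁) (u₂ , b₂ , e₂) (u₃ , b₃ , e₃) _) d≤d′ v∈ τv≡d′ =
    mkTight (u₁ , raise b₁ , e₁) (u₂ , raise b₂ , e₂) (u₃ , raise b₃ , e₃) (_ , v∈ , τv≡d′)
    where
    raise : ∀ {u} → Box F a b c d u → Box F a b c d′ u
    raise = Box-mono ≤-refl ≤-refl ≤-refl d≤d′

Enlargement-negateσ⁻ : ∀ {F A a b c d q} →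
                       Enlargement (negateσ F) A (- b) (- a) c d q → Enlargement F A a b c d q
Enlargement-negateσ⁻ {F} =
  Enlargement-swapAxes⁻ {F} ∘′ Enlargement-negateτ⁻ {swapAxes F} ∘′ Enlargement-swapAxes⁻ {negateτ (swapAxes F)}

-- Growing a box inside an absorbing set

Near : Subset → Point → Set
Near A u = A u ⊎ ∃[ z ] (A z × Adj u z)

Absorbing : Subset → Set
Absorbing A = ∀ v w → ∃[ z ] (A z × Adj v z) → (∀ u → Adj u v → u ≢ w → Near A u) → A v

walk-head : ∀ {A u w} → InfWalk A u w → A u
walk-head (InfWalk.here Au) = Au
walk-head (InfWalk.step Au _ _) = Au

record Hull (F : Frame) (A : Subset) (u : Point) (l : List Point) : Set where
  constructor hull
  field
    a b c d : ℤ
    filled : Filled F A a b c d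
    tight : Tight F a b c d
    ∋u : Box F a b c d u
    ⊇l : ∀ x → x ∈ l → Box F a b c d x

module Growth {A : Subset} (absorbing : Absorbing A) where

  module _ (F : Frame) {a b c d : ℤ} (filled : Filled F A a b c d) (tight : Tight F a b c d) where
    open Frame F

    west-near : ∀ u → τ u ≡ sucℤ d → a ≤ σ u → σ u ≤ b → Near A (west u)
    west-near u τu≡ a≤σu σu≤b with sucℤ (σ u) ≤? b | c ≤? pred d
    ... | yes room | _ =
      inj₁ (filled (west u) (box≡ (σ-west u) τw≡d (≤-trans a≤σu (i≤suc[i] (σ u))) room (Tight⇒c≤d tight) ≤-refl))
      where τw≡d = trans (τ-west u) (trans (cong pred τu≡) (pred-suc d))
    ... | no _ | yes c≤pred[d] =
      inj₂ (south (west u) , filled _ (box≡ σsw≡σu τsw≡pred[d] a≤σu σu≤b c≤pred[d] (pred[i]≤i d)) ,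
            Adj-sym (south (west u)) (west u) (south-adj (west u)))
      where
      σsw≡σu = trans (σ-south _) (trans (cong pred (σ-west u)) (pred-suc (σ u)))
      τsw≡pred[d] = trans (τ-south _) (trans (cong pred (τ-west u)) (cong pred (trans (cong pred τu≡) (pred-suc d))))
    ... | no full | no flat with Tight.σ-hi tight
    ...   | p , box _ _ c≤τp τp≤d , σp≡b =
      ⊥-elim (σ≡⇒τ≢suc F (trans (≤∧¬suc≤⇒≡ σu≤b full) (sym σp≡b)) (trans τu≡ (cong sucℤ (sym τp≡d))))
      where τp≡d = ≤-antisym τp≤d (≤-trans (¬≤pred⇒≤ flat) c≤τp)

    absorb-above : ∀ u → τ u ≡ sucℤ d → a ≤ pred (σ u) → σ u ≤ b → Near A (east u) → A u
    absorb-above u τu≡ a≤pred[σu] σu≤b near-east =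
      absorbing u (north u) (south u , A-south , Adj-sym (south u) u (south-adj u)) near
      where
      A-south : A (south u)
      A-south = filled (south u) (box≡ (σ-south u) (trans (τ-south u) (trans (cong pred τu≡) (pred-suc d)))
                                       a≤pred[σu] (i≤j⇒pred[i]≤j σu≤b) (Tight⇒c≤d tight) ≤-refl)
      near : ∀ x → Adj x u → x ≢ north u → Near A x
      near x adj x≢north with adj-cases x u adj
      ... | inj₁ refl = ⊥-elim (x≢north refl)
      ... | inj₂ (inj₁ refl) = near-east
      ... | inj₂ (inj₂ (inj₁ refl)) = inj₁ A-south
      ... | inj₂ (inj₂ (inj₂ refl)) = west-near u τu≡ (≤-trans a≤pred[σu] (pred[i]≤i (σ u))) σu≤b

    -- u is absorbed: its south neighbour lies in the box, and its east neighbour touches the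
    -- point two steps back along the row, absorbed by induction.
    rightward : ∀ q → A q → τ q ≡ sucℤ d → pred a ≤ σ q →
                ∀ n u → σ u ≡ σ q + + (n ℕ.+ n) → τ u ≡ sucℤ d → σ u ≤ b → A u
    rightward q Aq τq≡ _ zero u σu≡ τu≡ _ =
      subst A (στ-injective q u (sym (trans σu≡ (+-identityʳ (σ q)))) (trans τq≡ (sym τu≡))) Aq
    rightward q Aq τq≡ pred[a]≤σq (suc n) u σu≡ τu≡ σu≤b =
      absorb-above u τu≡ a≤pred[σu] σu≤b (inj₂ (w , Aw , Adj-sym (south (east u)) (east u) (south-adj (east u))))
      where
      back1 : ∀ s k → -1ℤ + (s + ((1ℤ + k) + (1ℤ + k))) ≡ 1ℤ + (s + (k + k))
      back1 = solve-∀
      back2 : ∀ s k → -1ℤ + (-1ℤ + (s + ((1ℤ + k) + (1ℤ + k)))) ≡ s + (k + k)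
      back2 = solve-∀
      w = south (east u)
      σw≡ : σ w ≡ pred (pred (σ u))
      σw≡ = trans (σ-south _) (cong pred (σ-east u))
      Aw : A w
      Aw = rightward q Aq τq≡ pred[a]≤σq n w
             (trans σw≡ (trans (cong (λ s → pred (pred s)) σu≡) (back2 (σ q) (+ n))))
             (trans (τ-south _) (trans (cong pred (τ-east u)) (trans (pred-suc (τ u)) τu≡)))
             (subst (_≤ b) (sym σw≡) (i≤j⇒pred[i]≤j (i≤j⇒pred[i]≤j σu≤b)))
      a≤pred[σu] : a ≤ pred (σ u)
      a≤pred[σu] = ≤-trans (pred≤⇒≤suc pred[a]≤σq)
                     (subst (sucℤ (σ q) ≤_) (sym (trans (cong pred σu≡) (back1 (σ q) (+ n))))
                            (suc-mono (i≤i+j (σ q) (+ (n ℕ.+ n)))))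

    north-of-top : ∀ p → Box F a b c d p → τ p ≡ d → sucℤ (σ p) ≤ b →
                   ∀ q → A q → σ q ≡ σ p → τ q ≡ sucℤ (sucℤ d) → A (north p)
    north-of-top p p∈ τp≡d room q Aq σq≡ τq≡ =
      absorb-above (north p) τn≡ a≤pred[σn] (subst (_≤ b) (sym (σ-north p)) room) (inj₁ (subst A q≡en Aq))
      where
      τn≡ : τ (north p) ≡ sucℤ d
      τn≡ = trans (τ-north p) (cong sucℤ τp≡d)
      pred[σn]≡σp : pred (σ (north p)) ≡ σ p
      pred[σn]≡σp = trans (cong pred (σ-north p)) (pred-suc (σ p))
      a≤pred[σn] : a ≤ pred (σ (north p))
      a≤pred[σn] = subst (a ≤_) (sym pred[σn]≡σp) (Box.a≤σ p∈)
      q≡en : q ≡ east (north p)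
      q≡en = στ-injective q _ (trans σq≡ (sym (trans (σ-east _) pred[σn]≡σp)))
                              (trans τq≡ (sym (trans (τ-east _) (cong sucℤ τn≡))))

  module _ (F : Frame) {a b c d : ℤ} (filled : Filled F A a b c d) (tight : Tight F a b c d) where
    open Frame F

    row-filled : ∀ q → A q → τ q ≡ sucℤ d → pred a ≤ σ q → σ q ≤ sucℤ b →
                 ∀ u → τ u ≡ sucℤ d → a ≤ σ u → σ u ≤ b → A u
    row-filled q Aq τq≡ pred[a]≤σq σq≤suc[b] u τu≡ a≤σu σu≤b with τ≡⇒σ-even-apart F (trans τu≡ (sym τq≡))
    ... | inj₁ (n , σu≡) = rightward F filled tight q Aq τq≡ pred[a]≤σq n u σu≡ τu≡ σu≤b
    ... | inj₂ (n , σq≡) =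
      rightward (negateσ F) (Filled-negateσ {F} filled) (Tight-negateσ {F} tight) q Aq τq≡
                (subst (_≤ - σ q) (neg-distrib-+ 1ℤ b) (neg-mono-≤ σq≤suc[b])) n u
                (trans (neg-shift (σ u) _) (cong (λ s → - s + _) (sym σq≡))) τu≡ (neg-mono-≤ a≤σu)
      where
      neg-shift : ∀ s k → - s ≡ - (s + k) + k
      neg-shift = solve-∀

    extend-top : ∀ v → A v → τ v ≡ sucℤ d → a ≤ σ v → σ v ≤ b →
                 Filled F A a b c (sucℤ d) × Tight F a b c (sucℤ d)
    extend-top v Av τv≡ a≤σv σv≤b =
      Filled-extend-top filled
        (row-filled v Av τv≡ (i≤j⇒pred[i]≤j a≤σv) (i≤j⇒i≤1+j σv≤b)) ,
      Tight-extend-top tight (i≤suc[i] d)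
        (box≡ refl τv≡ a≤σv σv≤b (≤-trans (Tight⇒c≤d tight) (i≤suc[i] d)) ≤-refl) τv≡

  module _ (F : Frame) {a b c d : ℤ} (filled : Filled F A a b c d) (tight : Tight F a b c d) where
    open Frame F

    grow-corner : ∀ q → A q → σ q ≡ sucℤ b → τ q ≡ sucℤ d → Enlargement F A a b c d q
    grow-corner q Aq σq≡ τq≡ = enlargement a (sucℤ b) c (sucℤ d) filled′ tight′ (λ _ → widen) q∈
      where
      widen : ∀ {u} → Box F a b c d u → Box F a (sucℤ b) c (sucℤ d) u
      widen = Box-mono ≤-refl (i≤suc[i] b) ≤-refl (i≤suc[i] d)
      b≤σq = ≤-trans (i≤suc[i] b) (≤-reflexive (sym σq≡))
      d≤τq = ≤-trans (i≤suc[i] d) (≤-reflexive (sym τq≡))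
      q∈ : Box F a (sucℤ b) c (sucℤ d) q
      q∈ = box≡ σq≡ τq≡ (≤-trans (Tight⇒a≤b tight) (i≤suc[i] b)) ≤-refl
                        (≤-trans (Tight⇒c≤d tight) (i≤suc[i] d)) ≤-refl
      row : ∀ u → τ u ≡ sucℤ d → a ≤ σ u → σ u ≤ b → A u
      row = row-filled F filled tight q Aq τq≡
              (≤-trans (pred[i]≤i a) (≤-trans (Tight⇒a≤b tight) b≤σq)) (≤-reflexive σq≡)
      column : ∀ u → σ u ≡ sucℤ b → c ≤ τ u → τ u ≤ d → A u
      column = row-filled (swapAxes F) (Filled-swapAxes {F} filled) (Tight-swapAxes {F} tight) q Aq σq≡
                 (≤-trans (pred[i]≤i c) (≤-trans (Tight⇒c≤d tight) d≤τq)) (≤-reflexive τq≡)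
      filled′ : Filled F A a (sucℤ b) c (sucℤ d)
      filled′ u (box a≤σ σ≤suc[b] c≤τ τ≤suc[d]) with σ u ≤? b | τ u ≤? d
      ... | yes σ≤b | yes τ≤d = filled u (box a≤σ σ≤b c≤τ τ≤d)
      ... | yes σ≤b | no τ≰d = row u (≤suc∧≰⇒≡suc τ≤suc[d] τ≰d) a≤σ σ≤b
      ... | no σ≰b | yes τ≤d = column u (≤suc∧≰⇒≡suc σ≤suc[b] σ≰b) c≤τ τ≤d
      ... | no σ≰b | no τ≰d =
        subst A (στ-injective q u (trans σq≡ (sym (≤suc∧≰⇒≡suc σ≤suc[b] σ≰b)))
                                  (trans τq≡ (sym (≤suc∧≰⇒≡suc τ≤suc[d] τ≰d)))) Aq
      tight′ : Tight F a (sucℤ b) c (sucℤ d)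
      tight′ =
        let (u₁ , b₁ , e₁) = Tight.σ-lo tight ; (u₃ , b₃ , e₃) = Tight.τ-lo tight in
        mkTight (u₁ , widen b₁ , e₁) (q , q∈ , σq≡) (u₃ , widen b₃ , e₃) (q , q∈ , τq≡)

    grow-two-rows-with-room : ∀ p → Box F a b c d p → τ p ≡ d → sucℤ (σ p) ≤ b →
                              ∀ q → A q → σ q ≡ σ p → τ q ≡ sucℤ (sucℤ d) → Enlargement F A a b c d q
    grow-two-rows-with-room p p∈ τp≡d room q Aq σq≡ τq≡
      with extend-top F filled tight (north p) (north-of-top F filled tight p p∈ τp≡d room q Aq σq≡ τq≡)
             (trans (τ-north p) (cong sucℤ τp≡d))
             (≤-trans (Box.a≤σ p∈) (≤-trans (i≤suc[i] (σ p)) (≤-reflexive (sym (σ-north p)))))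
             (subst (_≤ b) (sym (σ-north p)) room)
    ... | filled₁ , tight₁ with extend-top F filled₁ tight₁ q Aq τq≡ a≤σq σq≤b
      where
      a≤σq = subst (a ≤_) (sym σq≡) (Box.a≤σ p∈)
      σq≤b = subst (_≤ b) (sym σq≡) (Box.σ≤b p∈)
    ...   | filled₂ , tight₂ =
      enlargement a b c (sucℤ (sucℤ d)) filled₂ tight₂ (λ _ → Box-mono ≤-refl ≤-refl ≤-refl d≤d″)
        (box≡ σq≡ τq≡ (Box.a≤σ p∈) (Box.σ≤b p∈) (≤-trans (Tight⇒c≤d tight) d≤d″) ≤-refl)
      where d≤d″ = ≤-trans (i≤suc[i] d) (i≤suc[i] (sucℤ d))

    -- A box of width zero has no lattice point in the row just above it, by parity.
    grow-two-rows-thin : ∀ p → Box F a b c d p → τ p ≡ d → b ≤ σ p → σ p ≤ a →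
                         ∀ q → A q → σ q ≡ σ p → τ q ≡ sucℤ (sucℤ d) → Enlargement F A a b c d q
    grow-two-rows-thin p p∈ τp≡d b≤σp σp≤a q Aq σq≡ τq≡ =
      enlargement a b c (sucℤ (sucℤ d)) filled′ (Tight-extend-top tight d≤d″ q∈ τq≡)
        (λ _ → Box-mono ≤-refl ≤-refl ≤-refl d≤d″) q∈
      where
      d≤d″ = ≤-trans (i≤suc[i] d) (i≤suc[i] (sucℤ d))
      q∈ = box≡ σq≡ τq≡ (Box.a≤σ p∈) (Box.σ≤b p∈) (≤-trans (Tight⇒c≤d tight) d≤d″) ≤-refl
      σ≡σp : ∀ {u} → a ≤ σ u → σ u ≤ b → σ u ≡ σ p
      σ≡σp a≤σ σ≤b = ≤-antisym (≤-trans σ≤b b≤σp) (≤-trans σp≤a a≤σ)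
      filled′ : Filled F A a b c (sucℤ (sucℤ d))
      filled′ u (box a≤σ σ≤b c≤τ τ≤d″) with τ u ≤? d | τ u ≤? sucℤ d
      ... | yes τ≤d | _ = filled u (box a≤σ σ≤b c≤τ τ≤d)
      ... | no τ≰d | yes τ≤suc[d] =
        ⊥-elim (σ≡⇒τ≢suc F (σ≡σp a≤σ σ≤b) (trans (≤suc∧≰⇒≡suc τ≤suc[d] τ≰d) (cong sucℤ (sym τp≡d))))
      ... | no _ | no τ≰suc[d] =
        subst A (στ-injective q u (trans σq≡ (sym (σ≡σp a≤σ σ≤b)))
                                  (trans τq≡ (sym (≤suc∧≰⇒≡suc τ≤d″ τ≰suc[d])))) Aq

  module _ (F : Frame) {a b c d : ℤ} (filled : Filled F A a b c d) (tight : Tight F a b c d) where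
    open Frame F

    grow-row : ∀ q → A q → τ q ≡ sucℤ d → pred a ≤ σ q → σ q ≤ sucℤ b → Enlargement F A a b c d q
    grow-row q Aq τq≡ pred[a]≤σq σq≤suc[b] with σ q ≤? b | a ≤? σ q
    ... | no σq≰b | _ = grow-corner F filled tight q Aq (≤suc∧≰⇒≡suc σq≤suc[b] σq≰b) τq≡
    ... | yes _ | no a≰σq =
      Enlargement-negateσ⁻ {F} (grow-corner (negateσ F) (Filled-negateσ {F} filled) (Tight-negateσ {F} tight) q Aq
        (trans (cong -_ (pred≤∧≰⇒≡pred pred[a]≤σq a≰σq)) (neg-distrib-+ -1ℤ a)) τq≡)
    ... | yes σq≤b | yes a≤σq with extend-top F filled tight q Aq τq≡ a≤σq σq≤b
    ...   | filled′ , tight′ =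
      enlargement a b c (sucℤ d) filled′ tight′ (λ _ → Box-mono ≤-refl ≤-refl ≤-refl (i≤suc[i] d))
        (box≡ refl τq≡ a≤σq σq≤b (≤-trans (Tight⇒c≤d tight) (i≤suc[i] d)) ≤-refl)

    grow-two-rows : ∀ p → Box F a b c d p → τ p ≡ d →
                    ∀ q → A q → σ q ≡ σ p → τ q ≡ sucℤ (sucℤ d) → Enlargement F A a b c d q
    grow-two-rows p p∈ τp≡d q Aq σq≡ τq≡ with sucℤ (σ p) ≤? b | a ≤? pred (σ p)
    ... | yes room | _ = grow-two-rows-with-room F filled tight p p∈ τp≡d room q Aq σq≡ τq≡
    ... | no _ | yes room =
      Enlargement-negateσ⁻ {F} (grow-two-rows-with-room (negateσ F) (Filled-negateσ {F} filled) (Tight-negateσ {F} tight)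
        p (Box-negateσ {F} p∈) τp≡d (subst (_≤ - a) (neg-distrib-+ -1ℤ (σ p)) (neg-mono-≤ room))
        q Aq (cong -_ σq≡) τq≡)
    ... | no full | no full′ =
      grow-two-rows-thin F filled tight p p∈ τp≡d (¬suc≤⇒≤ full) (¬≤pred⇒≤ full′) q Aq σq≡ τq≡

  module _ (F : Frame) {a b c d : ℤ} (filled : Filled F A a b c d) (tight : Tight F a b c d) where
    open Frame F

    grow-above : ∀ p → Box F a b c d p → ∀ q → A q → AdjInf q p → sucℤ d ≤ τ q → Enlargement F A a b c d q
    grow-above p p∈ q Aq adj suc[d]≤τq
      with upward-step (σ q - σ p) (τ q - τ p) (Equivalence.to (AdjInf⇔step q p) adj) 1≤Δτ
      where
      1≤Δτ : 1ℤ ≤ τ q - τ p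
      1≤Δτ = subst (_≤ τ q - τ p) (suc[i]-i≡1 (τ p))
               (+-monoˡ-≤ (- τ p) (≤-trans (suc-mono (Box.τ≤d p∈)) suc[d]≤τq))
    ... | inj₁ (Δτ≡1 , Δσ≡±1) = grow-row F filled tight q Aq τq≡suc[d] pred[a]≤σq σq≤suc[b]
      where
      τq≡suc[d] = ≤-antisym (≤-trans (≤-reflexive (i-j≡k⇒i≡k+j Δτ≡1)) (suc-mono (Box.τ≤d p∈))) suc[d]≤τq
      σq≡σp±1 : σ q ≡ sucℤ (σ p) ⊎ σ q ≡ σ p ⊎ σ q ≡ pred (σ p)
      σq≡σp±1 = Sum.map i-j≡k⇒i≡k+j (inj₂ ∘′ i-j≡k⇒i≡k+j) Δσ≡±1
      pred[a]≤σq = proj₁ (within-one (Box.a≤σ p∈) (Box.σ≤b p∈) σq≡σp±1)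
      σq≤suc[b] = proj₂ (within-one (Box.a≤σ p∈) (Box.σ≤b p∈) σq≡σp±1)
    ... | inj₂ (Δτ≡2 , Δσ≡0) with d ≤? τ p
    ...   | yes d≤τp = grow-two-rows F filled tight p p∈ τp≡d q Aq σq≡σp
                         (trans τq≡2+τp (trans (cong (λ t → + 2 + t) τp≡d) (+-assoc 1ℤ 1ℤ d)))
      where
      τp≡d = ≤-antisym (Box.τ≤d p∈) d≤τp
      τq≡2+τp = i-j≡k⇒i≡k+j Δτ≡2
      σq≡σp = trans (i-j≡k⇒i≡k+j Δσ≡0) (+-identityˡ (σ p))
    ...   | no d≰τp = grow-row F filled tight q Aq τq≡suc[d]
                        (proj₁ (within-one (Box.a≤σ p∈) (Box.σ≤b p∈) (inj₂ (inj₁ σq≡σp))))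
                        (proj₂ (within-one (Box.a≤σ p∈) (Box.σ≤b p∈) (inj₂ (inj₁ σq≡σp))))
      where
      σq≡σp = trans (i-j≡k⇒i≡k+j Δσ≡0) (+-identityˡ (σ p))
      τq≡suc[d] = ≤-antisym (≤-trans (≤-reflexive (i-j≡k⇒i≡k+j Δτ≡2))
                               (≤-trans (+-monoʳ-≤ (+ 2) (i<j⇒i≤pred[j] (≰⇒> d≰τp))) (≤-reflexive (sym (+-assoc (+ 2) -1ℤ d)))))
                            suc[d]≤τq

  module _ (F : Frame) {a b c d : ℤ} (filled : Filled F A a b c d) (tight : Tight F a b c d) where
    open Frame F

    grow : ∀ p → Box F a b c d p → ∀ q → A q → AdjInf q p → Enlargement F A a b c d q
    grow p p∈ q Aq adj with τ q ≤? d | c ≤? τ q | σ q ≤? b | a ≤? σ q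
    ... | no τq≰d | _ | _ | _ = grow-above F filled tight p p∈ q Aq adj (¬≤⇒suc≤ τq≰d)
    ... | yes _ | no c≰τq | _ | _ =
      Enlargement-negateτ⁻ {F} (grow-above (negateτ F) (Filled-negateτ {F} filled) (Tight-negateτ {F} tight)
        p (Box-negateτ {F} p∈) q Aq adj (¬≤⇒suc[-]≤- c≰τq))
    ... | yes _ | yes _ | no σq≰b | _ =
      Enlargement-swapAxes⁻ {F} (grow-above (swapAxes F) (Filled-swapAxes {F} filled) (Tight-swapAxes {F} tight)
        p (Box-swapAxes {F} p∈) q Aq adj (¬≤⇒suc≤ σq≰b))
    ... | yes _ | yes _ | yes _ | no a≰σq =
      Enlargement-swapAxes⁻ {F} (Enlargement-negateτ⁻ {swapAxes F} (grow-above (negateτ (swapAxes F))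
        (Filled-negateτ {swapAxes F} (Filled-swapAxes {F} filled)) (Tight-negateτ {swapAxes F} (Tight-swapAxes {F} tight))
        p (Box-negateτ {swapAxes F} (Box-swapAxes {F} p∈)) q Aq adj (¬≤⇒suc[-]≤- a≰σq)))
    ... | yes τq≤d | yes c≤τq | yes σq≤b | yes a≤σq =
      enlargement a b c d filled tight (λ _ u∈ → u∈) (box a≤σq σq≤b c≤τq τq≤d)

  grow-along : ∀ F {a b c d u w} → Filled F A a b c d → Tight F a b c d → Box F a b c d u →
               InfWalk A u w → Enlargement F A a b c d w
  grow-along F filled tight u∈ (InfWalk.here _) = enlargement _ _ _ _ filled tight (λ _ x∈ → x∈) u∈
  grow-along F {u = u} filled tight u∈ (InfWalk.step {v = v} _ u~v walk)
    with grow F filled tight u u∈ v (walk-head walk) (AdjInf-sym u v u~v)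
  ... | enlargement _ _ _ _ filled₁ tight₁ ⊇old₁ ∋v with grow-along F filled₁ tight₁ ∋v walk
  ...   | enlargement a₂ b₂ c₂ d₂ filled₂ tight₂ ⊇old₂ ∋w =
    enlargement a₂ b₂ c₂ d₂ filled₂ tight₂ (λ x → ⊇old₂ x ∘′ ⊇old₁ x) ∋w

  hull-of-walks : ∀ F {u} (l : List Point) → A u → (∀ x → x ∈ l → InfWalk A u x) → Hull F A u l
  hull-of-walks F {u} [] Au _ = hull (σ u) (σ u) (τ u) (τ u) filled tight u∈ (λ _ ())
    where
    open Frame F
    u∈ : Box F (σ u) (σ u) (τ u) (τ u) u
    u∈ = box ≤-refl ≤-refl ≤-refl ≤-refl
    filled : Filled F A (σ u) (σ u) (τ u) (τ u)
    filled v (box σu≤σv σv≤σu τu≤τv τv≤τu) = subst A (στ-injective u v (≤-antisym σu≤σv σv≤σu) (≤-antisym τu≤τv τv≤τu)) Au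
    tight = mkTight (u , u∈ , refl) (u , u∈ , refl) (u , u∈ , refl) (u , u∈ , refl)
  hull-of-walks F (x ∷ l) Au walks with hull-of-walks F l Au (λ y → walks y ∘′ there)
  ... | hull _ _ _ _ filled tight ∋u ⊇l with grow-along F filled tight ∋u (walks x (here refl))
  ...   | enlargement a′ b′ c′ d′ filled′ tight′ ⊇old ∋x = hull a′ b′ c′ d′ filled′ tight′ (⊇old _ ∋u) ⊇x∷l
    where
    ⊇x∷l : ∀ y → y ∈ x ∷ l → Box F a′ b′ c′ d′ y
    ⊇x∷l y (here refl) = ∋x
    ⊇x∷l y (there y∈l) = ⊇old y (⊇l y y∈l)

Box₀⇔B : ∀ {a b c d u} → Box standardFrame a b c d u ⇔ B a b c d u
Box₀⇔B = mk⇔ (λ (box a≤σ σ≤b c≤τ τ≤d) → (a≤σ , σ≤b) , (c≤τ , τ≤d))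
             (λ ((a≤σ , σ≤b) , (c≤τ , τ≤d)) → box a≤σ σ≤b c≤τ τ≤d)

InfConnected∧Absorbing⇒IsBox : ∀ (L : List Point) {u} → u ∈ L → Absorbing ⟦ L ⟧ → InfConnected ⟦ L ⟧ → IsBox ⟦ L ⟧
InfConnected∧Absorbing⇒IsBox L {u} u∈L absorbing connected
  with Growth.hull-of-walks absorbing standardFrame L u∈L (λ x → connected u x u∈L)
... | hull a b c d filled _ ∋u ⊇L =
  a , b , c , d , (u , Equivalence.to (Box₀⇔B {u = u}) ∋u) ,
  λ x → mk⇔ (Equivalence.to (Box₀⇔B {u = x}) ∘′ ⊇L x) (filled x ∘′ Equivalence.from (Box₀⇔B {u = x}))

_≟ₚ_ : (u v : Point) → Dec (u ≡ v)
_≟ₚ_ = ≡-dec _≟_ _≟_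

open import Data.List.Membership.DecPropositional _≟ₚ_ using (_∈?_)

neighbours : List Point → List Point
neighbours [] = []
neighbours (z ∷ zs) = north₀ z ∷ east₀ z ∷ south₀ z ∷ west₀ z ∷ neighbours zs

neighbours⁻ : ∀ L {u} → u ∈ neighbours L → ∃[ z ] (z ∈ L × Adj u z)
neighbours⁻ (z ∷ zs) (here refl) = z , here refl , north₀-adj z
neighbours⁻ (z ∷ zs) (there (here refl)) = z , here refl , east₀-adj z
neighbours⁻ (z ∷ zs) (there (there (here refl))) = z , here refl , south₀-adj z
neighbours⁻ (z ∷ zs) (there (there (there (here refl)))) = z , here refl , west₀-adj z
neighbours⁻ (z ∷ zs) (there (there (there (there u∈)))) with neighbours⁻ zs u∈
... | y , y∈ , adj = y , there y∈ , adj

neighbours⁺ : ∀ L {u z} → z ∈ L → Adj u z → u ∈ neighbours L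
neighbours⁺ (z ∷ zs) {u} (here refl) adj with adj₀-cases u z adj
... | inj₁ refl = here refl
... | inj₂ (inj₁ refl) = there (here refl)
... | inj₂ (inj₂ (inj₁ refl)) = there (there (here refl))
... | inj₂ (inj₂ (inj₂ refl)) = there (there (there (here refl)))
neighbours⁺ (_ ∷ zs) (there z∈) adj = there (there (there (there (neighbours⁺ zs z∈ adj))))

boundary : List Point → List Point
boundary L = deduplicate _≟ₚ_ (filter (λ u → ¬? (u ∈? L)) (neighbours L))

boundary⇔∂ : ∀ L u → u ∈ boundary L ⇔ ∂ ⟦ L ⟧ u
boundary⇔∂ L u = mk⇔ to from
  where
  to : u ∈ boundary L → ∂ ⟦ L ⟧ u
  to u∈ with ∈-filter⁻ (λ u → ¬? (u ∈? L)) (∈-deduplicate⁻ _≟ₚ_ _ u∈)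
  ... | u∈nbrs , u∉L = u∉L , neighbours⁻ L u∈nbrs
  from : ∂ ⟦ L ⟧ u → u ∈ boundary L
  from (u∉L , z , z∈L , adj) = ∈-deduplicate⁺ _≟ₚ_ (∈-filter⁺ (λ u → ¬? (u ∈? L)) (neighbours⁺ L z∈L adj) u∉L)

boundary-size : ∀ L → HasSize (∂ ⟦ L ⟧) (length (boundary L))
boundary-size L = boundary L , deduplicate-! _≟ₚ_ _ , refl , boundary⇔∂ L

insert⇔∷ : ∀ L v u → insert ⟦ L ⟧ v u ⇔ ⟦ v ∷ L ⟧ u
insert⇔∷ L v u = mk⇔ (λ { (inj₁ u∈L) → there u∈L ; (inj₂ refl) → here refl })
                     (λ { (here refl) → inj₂ refl ; (there u∈L) → inj₁ u∈L })

∂-cong : ∀ {A A′ : Subset} → (∀ u → A u ⇔ A′ u) → ∀ {u} → ∂ A u ⇔ ∂ A′ u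
∂-cong A⇔A′ = mk⇔ (λ (u∉A , z , Az , adj) → u∉A ∘′ from (A⇔A′ _) , z , to (A⇔A′ z) Az , adj)
                  (λ (u∉A′ , z , A′z , adj) → u∉A′ ∘′ to (A⇔A′ _) , z , from (A⇔A′ z) A′z , adj)
  where open Equivalence

boundary-insert-size : ∀ L v → HasSize (∂ (insert ⟦ L ⟧ v)) (length (boundary (v ∷ L)))
boundary-insert-size L v =
  boundary (v ∷ L) , deduplicate-! _≟ₚ_ _ , refl ,
  λ u → mk⇔ (from (∂-cong (insert⇔∷ L v)) ∘′ to (boundary⇔∂ (v ∷ L) u))
            (from (boundary⇔∂ (v ∷ L) u) ∘′ to (∂-cong (insert⇔∷ L v)))
  where open Equivalence

-- If v were missing from A, adding it would remove v from the boundary and add at most w.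
Saturated⇒Absorbing : ∀ L → Saturated ⟦ L ⟧ → Absorbing ⟦ L ⟧
Saturated⇒Absorbing L saturated v w (z , z∈L , v~z) near with v ∈? L
... | yes v∈L = v∈L
... | no v∉L = ⊥-elim (ℕₚ.<⇒≱ grows (ℕ.s≤s⁻¹ (Unique-⊆⇒length≤ unique ⊆w∷∂L)))
  where
  open Equivalence
  grows : length (boundary L) ℕ.< length (boundary (v ∷ L))
  grows = saturated v v∉L _ _ (boundary-size L) (boundary-insert-size L v)
  unique : Unique (v ∷ boundary (v ∷ L))
  unique = All.tabulate (λ v∈∂ v≡ → proj₁ (to (boundary⇔∂ (v ∷ L) _) v∈∂) (here (sym v≡)))
           ∷ deduplicate-! _≟ₚ_ _
  ⊆w∷∂L : v ∷ boundary (v ∷ L) ⊆ w ∷ boundary L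
  ⊆w∷∂L (here refl) = there (from (boundary⇔∂ L v) (v∉L , z , z∈L , v~z))
  ⊆w∷∂L {x} (there x∈∂) with to (boundary⇔∂ (v ∷ L) x) x∈∂
  ... | x∉ , y , there y∈L , x~y = there (from (boundary⇔∂ L x) (x∉ ∘′ there , y , y∈L , x~y))
  ... | x∉ , _ , here refl , x~v with x ≟ₚ w
  ...   | yes refl = here refl
  ...   | no x≢w with near x x~v x≢w
  ...     | inj₁ x∈L = ⊥-elim (x∉ (there x∈L))
  ...     | inj₂ (y , y∈L , x~y) = there (from (boundary⇔∂ L x) (x∉ ∘′ there , y , y∈L , x~y))

-- Boxes are saturated

FarNeighbours : Subset → Point → Set
FarNeighbours A v = ∃[ u₁ ] ∃[ u₂ ] (Adj u₁ v × Adj u₂ v × u₁ ≢ u₂ × ¬ Near A u₁ × ¬ Near A u₂)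

-- Both far neighbours join the boundary, and at most v leaves it.
far-neighbours⇒boundary-grows : ∀ A v → ¬ A v → FarNeighbours A v →
                                ∀ m n → HasSize (∂ A) m → HasSize (∂ (insert A v)) n → m ℕ.< n
far-neighbours⇒boundary-grows A v v∉A (u₁ , u₂ , u₁~v , u₂~v , u₁≢u₂ , u₁-far , u₂-far) m n
                              (l , l-unique , refl , l⇔∂A) (l′ , _ , refl , l′⇔∂A+v) =
  ℕ.s≤s⁻¹ (Unique-⊆⇒length≤ unique ⊆v∷l′)
  where
  open Equivalence
  far⇒∉l : ∀ {u x} → ¬ Near A u → x ∈ l → u ≢ x
  far⇒∉l u-far x∈l refl = u-far (inj₂ (proj₂ (to (l⇔∂A _) x∈l)))
  unique : Unique (u₁ ∷ u₂ ∷ l)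
  unique = All.tabulate (λ { (here refl) → u₁≢u₂ ; (there x∈l) → far⇒∉l u₁-far x∈l })
         ∷ All.tabulate (far⇒∉l u₂-far) ∷ l-unique
  far⇒∈l′ : ∀ {u} → Adj u v → ¬ Near A u → u ∈ l′
  far⇒∈l′ {u} u~v u-far = from (l′⇔∂A+v u)
    ((λ { (inj₁ Au) → u-far (inj₁ Au) ; (inj₂ refl) → Adj-irrefl u u~v }) , v , inj₂ refl , u~v)
  ⊆v∷l′ : u₁ ∷ u₂ ∷ l ⊆ v ∷ l′
  ⊆v∷l′ (here refl) = there (far⇒∈l′ u₁~v u₁-far)
  ⊆v∷l′ (there (here refl)) = there (far⇒∈l′ u₂~v u₂-far)
  ⊆v∷l′ {x} (there (there x∈l)) with to (l⇔∂A x) x∈l | x ≟ₚ v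
  ... | _ | yes refl = here refl
  ... | x∉A , z , Az , x~z | no x≢v =
    there (from (l′⇔∂A+v x) ((λ { (inj₁ Ax) → x∉A Ax ; (inj₂ x≡v) → x≢v x≡v }) , z , inj₁ Az , x~z))

module _ (F : Frame) {A : Subset} {d : ℤ} (below : ∀ z → A z → Frame.τ F z ≤ d) where
  open Frame F

  pred[τ]≤τ-of-adj : ∀ u z → Adj u z → pred (τ u) ≤ τ z
  pred[τ]≤τ-of-adj u z adj with adj-cases u z adj
  ... | inj₁ refl = ≤-reflexive (trans (cong pred (τ-north z)) (pred-suc (τ z)))
  ... | inj₂ (inj₁ refl) = ≤-reflexive (trans (cong pred (τ-east z)) (pred-suc (τ z)))
  ... | inj₂ (inj₂ (inj₁ refl)) = ≤-trans (pred[i]≤i _) (≤-trans (≤-reflexive (τ-south z)) (pred[i]≤i (τ z)))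
  ... | inj₂ (inj₂ (inj₂ refl)) = ≤-trans (pred[i]≤i _) (≤-trans (≤-reflexive (τ-west z)) (pred[i]≤i (τ z)))

  far-above : ∀ u → sucℤ (sucℤ d) ≤ τ u → ¬ Near A u
  far-above u d+2≤τu (inj₁ Au) = suc≰ (≤-trans (i≤suc[i] _) (≤-trans d+2≤τu (below u Au)))
  far-above u d+2≤τu (inj₂ (z , Az , u~z)) =
    suc≰ (≤-trans (subst (_≤ pred (τ u)) (pred-suc (sucℤ d)) (pred-mono d+2≤τu))
                  (≤-trans (pred[τ]≤τ-of-adj u z u~z) (below z Az)))

  beyond-top⇒far : ∀ v → sucℤ d ≤ τ v → FarNeighbours A v
  beyond-top⇒far v d<τv =
    north v , east v , north-adj v , east-adj v , north≢east ,
    far-above (north v) (subst (_ ≤_) (sym (τ-north v)) (suc-mono d<τv)) ,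
    far-above (east v) (subst (_ ≤_) (sym (τ-east v)) (suc-mono d<τv))
    where
    north≢east : north v ≢ east v
    north≢east n≡e = suc≰ (≤-trans (≤-reflexive (trans (sym (σ-north v)) (trans (cong σ n≡e) (σ-east v))))
                                    (pred[i]≤i (σ v)))

module _ (F : Frame) {A : Subset} {a b c d : ℤ} (filled : Filled F A a b c d)
         (inside : ∀ u → A u → Box F a b c d u) where
  open Frame F

  outside⇒far : ∀ v → ¬ A v → FarNeighbours A v
  outside⇒far v v∉A with τ v ≤? d | c ≤? τ v | σ v ≤? b | a ≤? σ v
  ... | no τv≰d | _ | _ | _ = beyond-top⇒far F (λ z → Box.τ≤d ∘′ inside z) v (¬≤⇒suc≤ τv≰d)
  ... | yes _ | no c≰τv | _ | _ =
    beyond-top⇒far (negateτ F) (λ z → neg-mono-≤ ∘′ Box.c≤τ ∘′ inside z) v (¬≤⇒suc[-]≤- c≰τv)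
  ... | yes _ | yes _ | no σv≰b | _ = beyond-top⇒far (swapAxes F) (λ z → Box.σ≤b ∘′ inside z) v (¬≤⇒suc≤ σv≰b)
  ... | yes _ | yes _ | yes _ | no a≰σv =
    beyond-top⇒far (negateτ (swapAxes F)) (λ z → neg-mono-≤ ∘′ Box.a≤σ ∘′ inside z) v (¬≤⇒suc[-]≤- a≰σv)
  ... | yes τv≤d | yes c≤τv | yes σv≤b | yes a≤σv = ⊥-elim (v∉A (filled v (box a≤σv σv≤b c≤τv τv≤d)))

  Box⇒Saturated : Saturated A
  Box⇒Saturated v v∉A = far-neighbours⇒boundary-grows A v v∉A (outside⇒far v v∉A)

-- Boxes are ℓ∞-connected

module _ (F : Frame) {A : Subset} where
  open Frame F

  record Advance (k : ℕ) (u w : Point) : Set where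
    constructor advance
    field
      v : Point
      u~v : AdjInf u v
      σu≤σv : σ u ≤ σ v
      τu≤τv : τ u ≤ τ v
      σv≤σw : σ v ≤ σ w
      τv≤τw : τ v ≤ τ w
      remaining : (σ w - σ v) + (τ w - τ v) ≡ + (k ℕ.+ k)

  -- Each move raises σ + τ by 2, so walk-to inducts on half of the remaining σ + τ distance.
  advance-by : ∀ k {u w} v δσ δτ → σ v ≡ δσ + σ u → τ v ≡ δτ + τ u → δσ + δτ ≡ + 2 →
               DiagStep (- δσ) (- δτ) → 0ℤ ≤ δσ → 0ℤ ≤ δτ → σ v ≤ σ w → τ v ≤ τ w →
               (σ w - σ u) + (τ w - τ u) ≡ + (suc k ℕ.+ suc k) → Advance k u w
  advance-by k {u} {w} v δσ δτ σv≡ τv≡ gain diag 0≤δσ 0≤δτ σv≤σw τv≤τw total =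
    advance v u~v (raise σv≡ 0≤δσ) (raise τv≡ 0≤δτ) σv≤σw τv≤τw remaining
    where
    open ≡-Reasoning
    diff : ∀ s δ → s - (δ + s) ≡ - δ
    diff = solve-∀
    regroup : ∀ sw su tw tu δσ δτ → (sw - (δσ + su)) + (tw - (δτ + tu)) ≡ ((sw - su) + (tw - tu)) - (δσ + δτ)
    regroup = solve-∀
    drop2 : ∀ k → ((1ℤ + k) + (1ℤ + k)) - + 2 ≡ k + k
    drop2 = solve-∀
    raise : ∀ {x y δ} → y ≡ δ + x → 0ℤ ≤ δ → x ≤ y
    raise {x} {δ = δ} refl 0≤δ = subst (_≤ δ + x) (+-identityˡ x) (+-monoˡ-≤ x 0≤δ)
    u~v : AdjInf u v
    u~v = Equivalence.from (AdjInf⇔step u v)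
            (subst₂ DiagStep (sym (trans (cong (λ s → σ u - s) σv≡) (diff (σ u) δσ)))
                             (sym (trans (cong (λ t → τ u - t) τv≡) (diff (τ u) δτ))) diag)
    remaining : (σ w - σ v) + (τ w - τ v) ≡ + (k ℕ.+ k)
    remaining = begin
      (σ w - σ v) + (τ w - τ v)               ≡⟨ cong₂ (λ s t → (σ w - s) + (τ w - t)) σv≡ τv≡ ⟩
      (σ w - (δσ + σ u)) + (τ w - (δτ + τ u)) ≡⟨ regroup (σ w) (σ u) (τ w) (τ u) δσ δτ ⟩
      ((σ w - σ u) + (τ w - τ u)) - (δσ + δτ) ≡⟨ cong₂ _-_ total gain ⟩
      + (suc k ℕ.+ suc k) - + 2               ≡⟨ drop2 (+ k) ⟩
      + (k ℕ.+ k)                             ∎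

  gap≥2 : ∀ k {s s′ t t′} → t′ ≡ t → (s′ - s) + (t′ - t) ≡ + (suc k ℕ.+ suc k) → + 2 + s ≤ s′
  gap≥2 k {s} {s′} {t} refl total = subst (+ 2 + s ≤_) (sym s′≡) (+-monoˡ-≤ s (+≤+ (s≤s 1≤k+suc[k])))
    where
    1≤k+suc[k] = ℕₚ.≤-trans (s≤s z≤n) (ℕₚ.m≤n+m (suc k) k)
    s′≡ : s′ ≡ + (suc k ℕ.+ suc k) + s
    s′≡ = i-j≡k⇒i≡k+j (trans (sym (trans (cong (λ t → (s′ - s) + t) (+-inverseʳ t)) (+-identityʳ _))) total)

  no-distance : ∀ {u w} → σ u ≡ σ w → τ u ≡ τ w → (σ w - σ u) + (τ w - τ u) ≡ 0ℤ
  no-distance {u} eσ eτ = cong₂ _+_ (trans (cong (_- σ u) (sym eσ)) (+-inverseʳ (σ u)))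
                                    (trans (cong (_- τ u) (sym eτ)) (+-inverseʳ (τ u)))

  next-point : ∀ k {u w} → σ u ≤ σ w → τ u ≤ τ w → (σ w - σ u) + (τ w - τ u) ≡ + (suc k ℕ.+ suc k) →
               Advance k u w
  next-point k {u} {w} σu≤σw τu≤τw total with sucℤ (σ u) ≤? σ w | sucℤ (τ u) ≤? τ w
  ... | yes σ< | yes τ< =
    advance-by k (north u) 1ℤ 1ℤ (σ-north u) (τ-north u) refl refl (+≤+ z≤n) (+≤+ z≤n)
      (subst (_≤ σ w) (sym (σ-north u)) σ<) (subst (_≤ τ w) (sym (τ-north u)) τ<) total
  ... | yes σ< | no τ≮ =
    advance-by k (west (north u)) (+ 2) 0ℤ σv≡ τv≡ refl refl (+≤+ z≤n) ≤-refl
      (subst (_≤ σ w) (sym σv≡) (gap≥2 k (sym τu≡τw) total))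
      (subst (_≤ τ w) (sym τv≡) (≤-reflexive (trans (+-identityˡ (τ u)) τu≡τw))) total
    where
    τu≡τw = ≤∧¬suc≤⇒≡ τu≤τw τ≮
    σv≡ = trans (σ-west _) (trans (cong sucℤ (σ-north u)) (sym (+-assoc 1ℤ 1ℤ (σ u))))
    τv≡ = trans (τ-west _) (trans (cong pred (τ-north u)) (trans (pred-suc (τ u)) (sym (+-identityˡ (τ u)))))
  ... | no σ≮ | yes τ< =
    advance-by k (east (north u)) 0ℤ (+ 2) σv≡ τv≡ refl refl ≤-refl (+≤+ z≤n)
      (subst (_≤ σ w) (sym σv≡) (≤-reflexive (trans (+-identityˡ (σ u)) σu≡σw)))
      (subst (_≤ τ w) (sym τv≡) (gap≥2 k (sym σu≡σw) (trans (+-comm (τ w - τ u) (σ w - σ u)) total)))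
      total
    where
    σu≡σw = ≤∧¬suc≤⇒≡ σu≤σw σ≮
    σv≡ = trans (σ-east _) (trans (cong pred (σ-north u)) (trans (pred-suc (σ u)) (sym (+-identityˡ (σ u)))))
    τv≡ = trans (τ-east _) (trans (cong sucℤ (τ-north u)) (sym (+-assoc 1ℤ 1ℤ (τ u))))
  ... | no σ≮ | no τ≮ with trans (sym (no-distance (≤∧¬suc≤⇒≡ σu≤σw σ≮) (≤∧¬suc≤⇒≡ τu≤τw τ≮))) total
  ... | ()

  walk-to : ∀ k {u w} → σ u ≤ σ w → τ u ≤ τ w → (σ w - σ u) + (τ w - τ u) ≡ + (k ℕ.+ k) →
            Filled F A (σ u) (σ w) (τ u) (τ w) → InfWalk A u w
  walk-to zero {u} {w} σu≤σw τu≤τw total filled =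
    subst (InfWalk A u) (στ-injective u w (sym (i-j≡0⇒i≡j _ _ Δσ≡0)) (sym (i-j≡0⇒i≡j _ _ Δτ≡0)))
          (InfWalk.here (filled u (box ≤-refl σu≤σw ≤-refl τu≤τw)))
    where
    nonneg-sum≡0 : ∀ {x y} → 0ℤ ≤ x → 0ℤ ≤ y → x + y ≡ 0ℤ → x ≡ 0ℤ
    nonneg-sum≡0 {+ m} {+ n} _ _ e = cong +_ (ℕₚ.m+n≡0⇒m≡0 m (+-injective e))
    Δσ≡0 = nonneg-sum≡0 (i≤j⇒0≤j-i σu≤σw) (i≤j⇒0≤j-i τu≤τw) total
    Δτ≡0 = nonneg-sum≡0 (i≤j⇒0≤j-i τu≤τw) (i≤j⇒0≤j-i σu≤σw) (trans (+-comm (τ w - τ u) _) total)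
  walk-to (suc k) {u} {w} σu≤σw τu≤τw total filled with next-point k σu≤σw τu≤τw total
  ... | advance v u~v σu≤σv τu≤τv σv≤σw τv≤τw remaining =
    InfWalk.step (filled u (box ≤-refl σu≤σw ≤-refl τu≤τw)) u~v
      (walk-to k σv≤σw τv≤τw remaining (λ x → filled x ∘′ Box-mono σu≤σv ≤-refl τu≤τv ≤-refl))

  walk-within : ∀ {a b c d u w} → Filled F A a b c d → Box F a b c d u → Box F a b c d w →
                σ u ≤ σ w → τ u ≤ τ w → InfWalk A u w
  walk-within {u = u} {w} filled u∈ w∈ σu≤σw τu≤τw with parity w u
  ... | + n , total = walk-to n σu≤σw τu≤τw total
                        (λ x → filled x ∘′ Box-mono (Box.a≤σ u∈) (Box.σ≤b w∈) (Box.c≤τ u∈) (Box.τ≤d w∈))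
  ... | -[1+ m ] , total with subst (0ℤ ≤_) total (+-mono-≤ (i≤j⇒0≤j-i σu≤σw) (i≤j⇒0≤j-i τu≤τw))
  ...   | ()

Box⇒InfConnected : ∀ F {A a b c d} → Filled F A a b c d → (∀ u → A u → Box F a b c d u) → InfConnected A
Box⇒InfConnected F filled inside u w Au Aw with Frame.σ F u ≤? Frame.σ F w | Frame.τ F u ≤? Frame.τ F w
... | yes σ≤ | yes τ≤ = walk-within F filled (inside u Au) (inside w Aw) σ≤ τ≤
... | yes σ≤ | no τ≰ =
  walk-within (negateτ F) (Filled-negateτ {F} filled) (Box-negateτ {F} (inside u Au)) (Box-negateτ {F} (inside w Aw))
    σ≤ (neg-mono-≤ (≰⇒≥ τ≰))
... | no σ≰ | yes τ≤ =
  walk-within (negateσ F) (Filled-negateσ {F} filled) (Box-negateσ {F} (inside u Au)) (Box-negateσ {F} (inside w Aw))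
    (neg-mono-≤ (≰⇒≥ σ≰)) τ≤
... | no σ≰ | no τ≰ =
  walk-within (negateτ (negateσ F)) (Filled-negateτ {negateσ F} (Filled-negateσ {F} filled))
    (Box-negateτ {negateσ F} (Box-negateσ {F} (inside u Au))) (Box-negateτ {negateσ F} (Box-negateσ {F} (inside w Aw)))
    (neg-mono-≤ (≰⇒≥ σ≰)) (neg-mono-≤ (≰⇒≥ τ≰))

Box⇒InfConnected∧Saturated : ∀ {A a b c d} → (∀ u → A u ⇔ B a b c d u) → InfConnected A × Saturated A
Box⇒InfConnected∧Saturated {A} {a} {b} {c} {d} A⇔B =
  Box⇒InfConnected standardFrame filled inside , Box⇒Saturated standardFrame filled inside
  where
  filled : Filled standardFrame A a b c d
  filled u = Equivalence.from (A⇔B u) ∘′ Equivalence.to Box₀⇔B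
  inside : ∀ u → A u → Box standardFrame a b c d u
  inside u = Equivalence.from Box₀⇔B ∘′ Equivalence.to (A⇔B u)

proposition6p7 : (A : List Point) → (∃[ u ] (u ∈ A)) →
    (IsBox ⟦ A ⟧ ⇔ (InfConnected ⟦ A ⟧ × Saturated ⟦ A ⟧))
proposition6p7 A (u , u∈A) = mk⇔
  (λ (_ , _ , _ , _ , _ , A⇔B) → Box⇒InfConnected∧Saturated A⇔B)
  (λ (connected , saturated) →
     InfConnected∧Absorbing⇒IsBox A u∈A (Saturated⇒Absorbing A saturated) connected)
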